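{- For every graph $G$, $\mu\text{ - }tw(G) = \alpha\text{ - }tw(L^2(G))$.
   Context: Graphs are finite and simple. $L^2(G)$ is the graph with vertex set $E(G)$ in which two distinct edges $e,f$ of $G$ are adjacent iff their distance in the line graph of $G$ is at most $2$, i.e. iff $e$ and $f$ share a vertex or some edge of $G$ intersects both (equivalently, $G[e\cup f]$ is connected). A tree decomposition of a graph $G$ is a pair $(T,\{B_t\}_{t\in V(T)})$ where $T$ is a tree and each $B_t \subseteq V(G)$, such that for every vertex $x$ the nodes $t$ with $x \in B_t$ induce a connected subtree of $T$, and every edge of $G$ is contained in some bag. For $S \subseteq V(G)$, $\mu_G(S)$ is the maximum size of an induced matching $M$ of $G$ such that every edge of $M$ intersects $S$, and $\alpha_G(S) = \alpha(G[S])$. For $\lambda \in \{\mu,\alpha\}$, the $\lambda$-width of a decomposition is $\max_t\lambda_G(B_t)$ and $\lambda\text{ - }tw(G)$ is the minimum $\lambda$-width over all tree decompositions of $G$. -}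

module Defs where

open import Data.Bool using (Bool; true; false; T; not; _∧_; _∨_)
open import Data.Nat using (ℕ; _≤_)
open import Data.Fin using (Fin; toℕ)
import Data.Fin as F
open import Data.Fin.Properties using (_≟_)
open import Data.Product using (Σ; ∃; _×_; _,_; proj₁; proj₂)
open import Data.Unit using (⊤)
open import Data.List using (List; []; _∷_; length; _∷ʳ_)
open import Data.List.Relation.Unary.All using (All)
open import Data.List.Relation.Unary.AllPairs using (AllPairs)
open import Data.List.Relation.Unary.Unique.Propositional using (Unique)
open import Data.List.Relation.Unary.Linked using (Linked)
open import Relation.Nullary using (¬_; yes; no)
open import Data.Empty using (⊥-elim)
open import Relation.Nullary.Decidable using (⌊_⌋)
open import Relation.Binary.PropositionalEquality using (_≡_; _≢_; refl; trans; cong; cong₂)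
import Relation.Binary.PropositionalEquality as Eq
import Data.Sum

record SimpleGraph (V : Set) : Set where
  field
    adj    : V → V → Bool
    symm   : ∀ x y → adj x y ≡ adj y x
    irrefl : ∀ x → adj x x ≡ false

  Adj : V → V → Set
  Adj x y = T (adj x y)

open SimpleGraph public

data Walk {V : Set} (G : SimpleGraph V) (P : V → Set) : V → V → Set where
  stop : ∀ {x} → P x → Walk G P x x
  step : ∀ {x y z} → P x → Adj G x y → Walk G P y z → Walk G P x z

InducesConnected : {V : Set} → SimpleGraph V → (V → Set) → Set
InducesConnected {V} G P =
  (∃ λ x → P x) × (∀ x y → P x → P y → Walk G P x y)

HasCycle : {V : Set} → SimpleGraph V → Set
HasCycle {V} G =
  Σ V λ x → Σ (List V) λ ys →
    (2 ≤ length ys) × Unique (x ∷ ys) × Linked (Adj G) ((x ∷ ys) ∷ʳ x)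

IsTree : {m : ℕ} → SimpleGraph (Fin m) → Set
IsTree T = InducesConnected T (λ _ → ⊤) × ¬ HasCycle T

record TreeDecomposition {V : Set} (G : SimpleGraph V) : Set₁ where
  field
    nodes  : ℕ
    tree   : SimpleGraph (Fin nodes)
    isTree : IsTree tree
    bag    : Fin nodes → V → Set
    vertexConnected : ∀ x → InducesConnected tree (λ t → bag t x)
    edgeCovered : ∀ x y → Adj G x y → ∃ λ t → bag t x × bag t y

open TreeDecomposition public

IndependentIn : {V : Set} → SimpleGraph V → (V → Set) → List V → Set
IndependentIn G S xs =
  All S xs × AllPairs (λ x y → x ≢ y × ¬ Adj G x y) xs

InducedApart : {V : Set} → SimpleGraph V → (V × V) → (V × V) → Set
InducedApart G (a , b) (c , d) =
  (a ≢ c × ¬ Adj G a c) × (a ≢ d × ¬ Adj G a d) ×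
  (b ≢ c × ¬ Adj G b c) × (b ≢ d × ¬ Adj G b d)

InducedMatchingMeeting : {V : Set} → SimpleGraph V → (V → Set) → List (V × V) → Set
InducedMatchingMeeting G S es =
  All (λ e → Adj G (proj₁ e) (proj₂ e)) es ×
  AllPairs (InducedApart G) es ×
  All (λ e → S (proj₁ e) Data.Sum.⊎ S (proj₂ e)) es

α≤ : {V : Set} → SimpleGraph V → (V → Set) → ℕ → Set
α≤ {V} G S k = ∀ (xs : List V) → IndependentIn G S xs → length xs ≤ k

μ≤ : {V : Set} → SimpleGraph V → (V → Set) → ℕ → Set
μ≤ {V} G S k = ∀ (es : List (V × V)) → InducedMatchingMeeting G S es → length es ≤ k

α≥ : {V : Set} → SimpleGraph V → (V → Set) → ℕ → Set
α≥ {V} G S k = Σ (List V) λ xs → IndependentIn G S xs × k ≤ length xs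

μ≥ : {V : Set} → SimpleGraph V → (V → Set) → ℕ → Set
μ≥ {V} G S k = Σ (List (V × V)) λ es → InducedMatchingMeeting G S es × k ≤ length es

-- λ-tw(G) = k  ⇔  (some decomposition has max_t λ(B_t) ≤ k) and
--                 (every decomposition has some bag with λ(B_t) ≥ k)

IsAlphaTw : {V : Set} → SimpleGraph V → ℕ → Set₁
IsAlphaTw G k =
  (Σ (TreeDecomposition G) λ D → ∀ t → α≤ G (bag D t) k) ×
  (∀ (D : TreeDecomposition G) → ∃ λ t → α≥ G (bag D t) k)

IsMuTw : {V : Set} → SimpleGraph V → ℕ → Set₁
IsMuTw G k =
  (Σ (TreeDecomposition G) λ D → ∀ t → μ≤ G (bag D t) k) ×
  (∀ (D : TreeDecomposition G) → ∃ λ t → μ≥ G (bag D t) k)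

-- an edge {u,v} is represented as u < v with u ~ v
Edge : {n : ℕ} → SimpleGraph (Fin n) → Set
Edge {n} G = Σ (Fin n × Fin n) λ p → (proj₁ p F.< proj₂ p) × Adj G (proj₁ p) (proj₂ p)

private
  _==_ : {n : ℕ} → Fin n → Fin n → Bool
  x == y = ⌊ x ≟ y ⌋

  touch : {n : ℕ} → SimpleGraph (Fin n) → Fin n → Fin n → Bool
  touch G x y = (x == y) ∨ adj G x y

-- e ≠ f and G[e ∪ f] connected, i.e. e,f share a vertex or an edge of G
-- joins an endpoint of e to an endpoint of f.
L2adj : {n : ℕ} (G : SimpleGraph (Fin n)) → Edge G → Edge G → Bool
L2adj G ((a , b) , _) ((c , d) , _) =
  not ((a == c) ∧ (b == d)) ∧
  (touch G a c ∨ touch G a d ∨ touch G b c ∨ touch G b d)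

private
  ==-sym : {n : ℕ} (x y : Fin n) → (x == y) ≡ (y == x)
  ==-sym x y with x ≟ y | y ≟ x
  ... | yes _ | yes _ = refl
  ... | no _  | no _  = refl
  ... | yes p | no q  = ⊥-elim (q (Eq.sym p))
  ... | no p  | yes q = ⊥-elim (p (Eq.sym q))

  ==-refl : {n : ℕ} (x : Fin n) → (x == x) ≡ true
  ==-refl x with x ≟ x
  ... | yes _ = refl
  ... | no p  = ⊥-elim (p refl)

  touch-sym : {n : ℕ} (G : SimpleGraph (Fin n)) (x y : Fin n) → touch G x y ≡ touch G y x
  touch-sym G x y = cong₂ _∨_ (==-sym x y) (SimpleGraph.symm G x y)

  swap-mid : ∀ p q r s → (p ∨ q ∨ r ∨ s) ≡ (p ∨ r ∨ q ∨ s)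
  swap-mid true  q r s = refl
  swap-mid false true true s = refl
  swap-mid false true false s = refl
  swap-mid false false true s = refl
  swap-mid false false false s = refl

  L2adj-sym : {n : ℕ} (G : SimpleGraph (Fin n)) (e f : Edge G) → L2adj G e f ≡ L2adj G f e
  L2adj-sym G ((a , b) , _) ((c , d) , _) =
    cong₂ _∧_ (cong not (cong₂ _∧_ (==-sym a c) (==-sym b d)))
      (trans (swap-mid (touch G a c) (touch G a d) (touch G b c) (touch G b d))
        (cong₂ _∨_ (touch-sym G a c) (cong₂ _∨_ (touch-sym G b c)
          (cong₂ _∨_ (touch-sym G a d) (touch-sym G b d)))))

  L2adj-irrefl : {n : ℕ} (G : SimpleGraph (Fin n)) (e : Edge G) → L2adj G e e ≡ false
  L2adj-irrefl G ((a , b) , _) rewrite ==-refl a | ==-refl b = refl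

L² : {n : ℕ} (G : SimpleGraph (Fin n)) → SimpleGraph (Edge G)
L² G = record { adj = L2adj G ; symm = L2adj-sym G ; irrefl = L2adj-irrefl G }

module Submission where

-- A tree decomposition of G gives one of L²(G) on the same tree by letting the bag of t
-- consist of the edges meeting B_t.  Conversely, from a decomposition of L²(G) put v into
-- the bag of t when every edge at v lies in the bag of t: the edges at v, and the edges at
-- the two ends of an edge uv, are pairwise adjacent or equal in L²(G), so by the Helly
-- property of subtrees some bag contains all of them, and the nodes whose bags contain
-- them all form a subtree.  In both constructions every edge meeting a bag of G lies in
-- the matching bag of L²(G) (with equality for the first), and the independent sets of
-- L²(G) made of edges meeting S are exactly the induced matchings of G meeting S.

open import Defs
open import Data.Nat using (ℕ; suc; s≤s; z≤n) renaming (_≤_ to _≤ℕ_)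
open import Data.Nat.Properties using (≤-refl; ≤-trans)
open import Data.Fin using (Fin)
import Data.Fin.Properties as Fin
open import Data.Bool using (Bool; T; not; _∧_; _∨_)
open import Data.Bool.Properties using (T-∧; T-∨; T-irrelevant)
open import Data.Product using (Σ; ∃; _×_; _,_; proj₁; proj₂; uncurry; curry)
import Data.Product as Product
open import Function using (_∘_)
open import Data.Product.Properties using (≡-dec)
open import Data.Sum using (_⊎_; inj₁; inj₂; [_,_]′)
import Data.Sum as Sum
open import Data.Unit using (tt)
open import Data.List using (List; []; _∷_; _++_; length; map; allFin; cartesianProduct; concatMap; filter)
open import Data.List.Properties using (length-map)
open import Data.List.Relation.Unary.All using (All; []; _∷_)
import Data.List.Relation.Unary.All as All
import Data.List.Relation.Unary.All.Properties as All
open import Data.List.Relation.Unary.Any using (here; there)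
open import Data.List.Relation.Unary.AllPairs using (AllPairs; []; _∷_)
import Data.List.Relation.Unary.AllPairs as AllPairs
import Data.List.Relation.Unary.AllPairs.Properties as AllPairs
open import Data.List.Relation.Unary.Unique.Propositional using (Unique)
import Data.List.Relation.Unary.Unique.Propositional.Properties as Unique
open import Data.List.Relation.Unary.Linked using (Linked; [-]; _∷_)
open import Data.List.Membership.Propositional using (_∈_; _∉_; lose)
open import Data.List.Membership.Propositional.Properties
  using (∈-++⁺ʳ; ∈-allFin; ∈-cartesianProduct⁺; ∈-concatMap⁺; ∈-filter⁺; ∈-filter⁻)
open import Function.Bundles using (_⇔_; mk⇔; Equivalence)
open import Function.Properties.Equivalence using () renaming (refl to ⇔-refl; trans to ⇔-trans)
open import Data.Sum.Function.Propositional using (_⊎-⇔_)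
open import Data.Product.Function.NonDependent.Propositional using (_×-⇔_)
open import Relation.Binary.Definitions using (DecidableEquality; tri<; tri≈; tri>)
open import Relation.Binary.PropositionalEquality using (_≡_; _≢_; refl; sym; cong; cong₂; subst)
open import Relation.Nullary using (¬_; yes; no; contradiction)
open import Relation.Nullary.Decidable using (T?; isYes; _⊎-dec_; toWitness; fromWitness)
open import Relation.Unary using (Satisfiable; Decidable; _∩_; _∪_; _⊆_; ｛_｝; U)

Unique-++⁻ˡ : {A : Set} (xs : List A) {ys : List A} → Unique (xs ++ ys) → Unique xs
Unique-++⁻ˡ []       _          = []
Unique-++⁻ˡ (x ∷ xs) (x∉ ∷ xs!) = All.++⁻ˡ xs x∉ ∷ Unique-++⁻ˡ xs xs!

Unique-++⁻ʳ : {A : Set} (xs : List A) {ys : List A} → Unique (xs ++ ys) → Unique ys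
Unique-++⁻ʳ []       ys!       = ys!
Unique-++⁻ʳ (x ∷ xs) (_ ∷ xs!) = Unique-++⁻ʳ xs xs!

module _ {A B : Set} {P : A → Set} (f : ∀ {x} → P x → B) where

  length-reduce : ∀ {xs} (pxs : All P xs) → length (All.reduce f pxs) ≡ length xs
  length-reduce []         = refl
  length-reduce (_ ∷ pxs) = cong suc (length-reduce pxs)

  All-reduce : ∀ {Q : A → Set} {R : B → Set} → (∀ {x} (px : P x) → Q x → R (f px)) →
               ∀ {xs} (pxs : All P xs) → All Q xs → All R (All.reduce f pxs)
  All-reduce g []         []         = []
  All-reduce g (px ∷ pxs) (qx ∷ qxs) = g px qx ∷ All-reduce g pxs qxs

  AllPairs-reduce : ∀ {Q : A → A → Set} {R : B → B → Set} →
                    (∀ {x y} (px : P x) (py : P y) → Q x y → R (f px) (f py)) →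
                    ∀ {xs} (pxs : All P xs) → AllPairs Q xs → AllPairs R (All.reduce f pxs)
  AllPairs-reduce g []         []           = []
  AllPairs-reduce g (px ∷ pxs) (qxs ∷ qxss) = All-reduce (g px) pxs qxs ∷ AllPairs-reduce g pxs qxss

Touch : {V : Set} → SimpleGraph V → V → V → Set
Touch G x y = x ≡ y ⊎ Adj G x y

Connected : {V : Set} → SimpleGraph V → (V → Set) → Set
Connected G S = ∀ x y → S x → S y → Walk G S x y

Adj-sym : {V : Set} (G : SimpleGraph V) {x y : V} → Adj G x y → Adj G y x
Adj-sym G {x} {y} = subst T (symm G x y)

¬Adj-refl : {V : Set} (G : SimpleGraph V) {x : V} → ¬ Adj G x x
¬Adj-refl G {x} = subst T (irrefl G x)

module _ {V : Set} {G : SimpleGraph V} where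

  vertices : ∀ {P x y} → Walk G P x y → List V
  vertices {x = x} (stop _)     = x ∷ []
  vertices {x = x} (step _ _ w) = x ∷ vertices w

  initVertices : ∀ {P x y} → Walk G P x y → List V
  initVertices (stop _)             = []
  initVertices {x = x} (step _ _ w) = x ∷ initVertices w

  IsPath : ∀ {P x y} → Walk G P x y → Set
  IsPath w = Unique (vertices w)

  start∈vertices : ∀ {P x y} (w : Walk G P x y) → x ∈ vertices w
  start∈vertices (stop _)     = here refl
  start∈vertices (step _ _ _) = here refl

  end∈vertices : ∀ {P x y} (w : Walk G P x y) → y ∈ vertices w
  end∈vertices (stop _)     = here refl
  end∈vertices (step _ _ w) = there (end∈vertices w)

  start-inside : ∀ {P x y} → Walk G P x y → P x
  start-inside (stop px)     = px
  start-inside (step px _ _) = px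

  All-vertices : ∀ {P x y} (w : Walk G P x y) → All P (vertices w)
  All-vertices (stop px)     = px ∷ []
  All-vertices (step px _ w) = px ∷ All-vertices w

  restrict : ∀ {P Q x y} (w : Walk G Q x y) → All P (vertices w) → Walk G P x y
  restrict (stop _)     (px ∷ [])  = stop px
  restrict (step _ a w) (px ∷ pxs) = step px a (restrict w pxs)

  mapᵂ : ∀ {P Q x y} → P ⊆ Q → Walk G P x y → Walk G Q x y
  mapᵂ f (stop px)     = stop (f px)
  mapᵂ f (step px a w) = step (f px) a (mapᵂ f w)

  _++ᵂ_ : ∀ {P x y z} → Walk G P x y → Walk G P y z → Walk G P x z
  stop _     ++ᵂ w′ = w′
  step p a w ++ᵂ w′ = step p a (w ++ᵂ w′)

  vertices-++ᵂ : ∀ {P x y z} (w : Walk G P x y) (w′ : Walk G P y z) →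
                 vertices (w ++ᵂ w′) ≡ initVertices w ++ vertices w′
  vertices-++ᵂ (stop _)           w′ = refl
  vertices-++ᵂ {x = x} (step _ _ w) w′ = cong (x ∷_) (vertices-++ᵂ w w′)

  reverseᵂ : ∀ {P x y} → Walk G P x y → Walk G P y x
  reverseᵂ (stop px)     = stop px
  reverseᵂ (step px a w) = reverseᵂ w ++ᵂ step (start-inside w) (Adj-sym G a) (stop px)

  suffixFrom : ∀ {P x z v} (w : Walk G P x z) → v ∈ vertices w →
               Σ (Walk G P v z) λ s → ∃ λ pre → vertices w ≡ pre ++ vertices s
  suffixFrom w@(stop _)     (here refl) = w , [] , refl
  suffixFrom w@(step _ _ _) (here refl) = w , [] , refl
  suffixFrom {x = x} (step _ _ w) (there v∈) with s , pre , eq ← suffixFrom w v∈ =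
    s , x ∷ pre , cong (x ∷_) eq

  ∪-connected : ∀ {X Y} → InducesConnected G X → InducesConnected G Y → Satisfiable (X ∩ Y) →
                InducesConnected G (X ∪ Y)
  ∪-connected {X} {Y} (_ , cX) (_ , cY) (s , Xs , Ys) =
    (s , inj₁ Xs) , λ x y x∈ y∈ → toS x x∈ ++ᵂ reverseᵂ (toS y y∈)
    where
    toS : ∀ x → (X ∪ Y) x → Walk G (X ∪ Y) x s
    toS x (inj₁ Xx) = mapᵂ inj₁ (cX x s Xx Xs)
    toS x (inj₂ Yx) = mapᵂ inj₂ (cY x s Yx Ys)

module Paths {V : Set} (_≟_ : DecidableEquality V) {Γ : SimpleGraph V} where
  open import Data.List.Membership.DecPropositional _≟_ using (_∈?_)

  shortcut : ∀ {P x y} → Walk Γ P x y → Σ (Walk Γ P x y) IsPath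
  shortcut (stop px) = stop px , [] ∷ []
  shortcut {x = x} (step px a w) with shortcut w
  ... | p , p-path with x ∈? vertices p
  ...   | no x∉p = step px a p , All.¬Any⇒All¬ _ x∉p ∷ p-path
  ...   | yes x∈p with s , pre , eq ← suffixFrom p x∈p =
          s , Unique-++⁻ʳ pre (subst Unique eq p-path)

  splitAtFirst : ∀ {P x y} (w : Walk Γ P x y) (L : List V) → y ∈ L →
                 ∃ λ m → Σ (Walk Γ P x m) λ b → Σ (Walk Γ P m y) λ c →
                   m ∈ L × All (_∉ L) (initVertices b) × vertices w ≡ initVertices b ++ vertices c
  splitAtFirst {x = x} w L y∈L with x ∈? L
  ... | yes x∈L = x , stop (start-inside w) , w , x∈L , [] , refl
  splitAtFirst (stop _) L y∈L | no x∉L = contradiction y∈L x∉L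
  splitAtFirst {x = x} (step px a w) L y∈L | no x∉L
    with m , b , c , m∈L , b∉L , eq ← splitAtFirst w L y∈L =
    m , step px a b , c , m∈L , x∉L ∷ b∉L , cong (x ∷_) eq

  module Acyclic (acyclic : ¬ HasCycle Γ) where

    linked-around : ∀ {P x p q z} → Adj Γ x p → (w : Walk Γ P p q) → Adj Γ q z →
                    Linked (Adj Γ) (x ∷ vertices w ++ z ∷ [])
    linked-around a (stop _)     b = a ∷ b ∷ [-]
    linked-around a (step _ c w) b = a ∷ linked-around c w b

    -- A detour from p to q avoiding their common neighbour x would close a cycle through x.
    ¬detour : ∀ {x p q} → Adj Γ x p → Adj Γ x q → p ≢ q → ¬ Walk Γ (x ≢_) p q
    ¬detour {x} x~p x~q p≢q w with r , r-path ← shortcut w =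
      acyclic (x , vertices r , two≤ r , All-vertices r ∷ r-path , linked-around x~p r (Adj-sym Γ x~q))
      where
      two≤ : (r : Walk Γ (x ≢_) _ _) → 2 ≤ℕ length (vertices r)
      two≤ (stop _)                 = contradiction refl p≢q
      two≤ (step _ _ (stop _))      = s≤s (s≤s z≤n)
      two≤ (step _ _ (step _ _ _)) = s≤s (s≤s z≤n)

    paths-unique : ∀ {P Q x y} (p : Walk Γ P x y) (q : Walk Γ Q x y) →
                   IsPath p → IsPath q → vertices p ≡ vertices q
    paths-unique (stop _)     (stop _)     _ _ = refl
    paths-unique (stop _) (step _ _ q) _ (x∉q ∷ _) =
      contradiction refl (All.lookup x∉q (end∈vertices q))
    paths-unique (step _ _ p) (stop _) (x∉p ∷ _) _ =
      contradiction refl (All.lookup x∉p (end∈vertices p))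
    paths-unique {x = x} (step {y = p₀} _ x~p₀ p) (step {y = q₀} _ x~q₀ q)
                 (x∉p ∷ p-path) (x∉q ∷ q-path)
      with p₀ ≟ q₀
    ... | yes refl = cong (x ∷_) (paths-unique p q p-path q-path)
    ... | no p₀≢q₀ =
      contradiction (restrict p x∉p ++ᵂ reverseᵂ (restrict q x∉q)) (¬detour x~p₀ x~q₀ p₀≢q₀)

    path-within : ∀ {P S x y} (p : Walk Γ P x y) → IsPath p → Walk Γ S x y → All S (vertices p)
    path-within p p-path w with r , r-path ← shortcut w =
      subst (All _) (sym (paths-unique p r p-path r-path)) (All-vertices r)

    ∩-connected : ∀ {X Y} → InducesConnected Γ X → InducesConnected Γ Y →
                  Satisfiable (X ∩ Y) → InducesConnected Γ (X ∩ Y)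
    ∩-connected (_ , cX) (_ , cY) X∩Y = X∩Y , λ x y (Xx , Yx) (Xy , Yy) →
      let p , p-path = shortcut (cX x y Xx Xy)
      in restrict p (All.zip (All-vertices p , path-within p p-path (cY x y Yx Yy)))

    -- The first vertex m of the b–a path lying on the a–c path is on the b–c path as well.
    median : ∀ {X Y Z} → Connected Γ X → Connected Γ Y → Connected Γ Z →
             Satisfiable (X ∩ Y) → Satisfiable (Y ∩ Z) → Satisfiable (X ∩ Z) →
             Satisfiable ((X ∩ Y) ∩ Z)
    median cX cY cZ (a , Xa , Ya) (b , Yb , Zb) (c , Xc , Zc)
      with P , P-path ← shortcut (mapᵂ {Q = U} _ (cY b a Yb Ya))
         | Q , Q-path ← shortcut (mapᵂ {Q = U} _ (cX a c Xa Xc))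
      with m , B , C , m∈Q , B∉Q , P≡BC ← splitAtFirst P (vertices Q) (start∈vertices Q)
      with D , pre , Q≡preD ← suffixFrom Q m∈Q =
      m , (on Q Q-path (cX a c Xa Xc) m∈Q , on P P-path (cY b a Yb Ya) m∈P) ,
      on (B ++ᵂ D) BD-path (cZ b c Zb Zc) m∈BD
      where
      on : ∀ {S x y} (p : Walk Γ U x y) → IsPath p → Walk Γ S x y →
           ∀ {v} → v ∈ vertices p → S v
      on p p-path w = All.lookup (path-within p p-path w)
      m∈P : m ∈ vertices P
      m∈P = subst (m ∈_) (sym P≡BC) (∈-++⁺ʳ (initVertices B) (start∈vertices C))
      BD-path : IsPath (B ++ᵂ D)
      BD-path = subst Unique (sym (vertices-++ᵂ B D))
        (Unique.++⁺ (Unique-++⁻ˡ (initVertices B) (subst Unique P≡BC P-path))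
                    (Unique-++⁻ʳ pre (subst Unique Q≡preD Q-path))
                    λ (v∈B , v∈D) →
                      All.lookup B∉Q v∈B (subst (_ ∈_) (sym Q≡preD) (∈-++⁺ʳ pre v∈D)))
      m∈BD : m ∈ vertices (B ++ᵂ D)
      m∈BD = subst (m ∈_) (sym (vertices-++ᵂ B D)) (∈-++⁺ʳ (initVertices B) (start∈vertices D))

module Trees {N : ℕ} {Γ : SimpleGraph (Fin N)} (isTree : IsTree Γ) where
  open Paths Fin._≟_ {Γ}
  open Acyclic (proj₂ isTree)

  ⋂-connected : ∀ {I : Set} {S : I → Fin N → Set} → (∀ i → Connected Γ (S i)) →
                Connected Γ (λ t → ∀ i → S i t)
  ⋂-connected cS x y Sx Sy with p , p-path ← shortcut (proj₂ (proj₁ isTree) x y tt tt) =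
    restrict p (All.tabulate λ v∈p i → All.lookup (path-within p p-path (cS i x y (Sx i) (Sy i))) v∈p)

  -- Induction on the family, replacing X by X ∩ S j; the median lemma keeps the new X meeting every S i.
  helly-within : ∀ {I : Set} {X : Fin N → Set} (is : List I) (S : I → Fin N → Set) →
                 InducesConnected Γ X → (∀ {i} → i ∈ is → InducesConnected Γ (S i)) →
                 (∀ {i} → i ∈ is → Satisfiable (X ∩ S i)) →
                 (∀ {i j} → i ∈ is → j ∈ is → Satisfiable (S i ∩ S j)) →
                 Satisfiable (X ∩ λ t → ∀ {i} → i ∈ is → S i t)
  helly-within [] S cX _ _ _ with t , Xt ← proj₁ cX = t , Xt , λ ()
  helly-within (j ∷ is) S cX cS X∩S S∩S
    with t , (Xt , Sjt) , Sit ←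
           helly-within is S (∩-connected cX (cS (here refl)) (X∩S (here refl))) (cS ∘ there)
             (λ i∈ → median (proj₂ cX) (proj₂ (cS (here refl))) (proj₂ (cS (there i∈)))
                            (X∩S (here refl)) (S∩S (here refl) (there i∈)) (X∩S (there i∈)))
             (λ i∈ j∈ → S∩S (there i∈) (there j∈))
    = t , Xt , λ { (here refl) → Sjt ; (there i∈) → Sit i∈ }

  helly : ∀ {I : Set} (is : List I) (S : I → Fin N → Set) →
          (∀ {i} → i ∈ is → InducesConnected Γ (S i)) →
          (∀ {i j} → i ∈ is → j ∈ is → Satisfiable (S i ∩ S j)) →
          ∃ λ t → ∀ {i} → i ∈ is → S i t
  helly is S cS S∩S = Product.map₂ proj₂ (helly-within is S (proj₁ isTree) cS U∩S S∩S)
    where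
    U∩S : ∀ {i} → i ∈ is → Satisfiable (U ∩ S i)
    U∩S i∈ with t , Sit , _ ← S∩S i∈ i∈ = t , tt , Sit

module _ {V : Set} {H : SimpleGraph V} (D : TreeDecomposition H) where
  open Trees (isTree D)

  touch-covered : ∀ {x y} → Touch H x y → ∃ λ t → bag D t x × bag D t y
  touch-covered {x} (inj₁ refl) with t , x∈t ← proj₁ (vertexConnected D x) = t , x∈t , x∈t
  touch-covered {x} {y} (inj₂ x~y) = edgeCovered D x y x~y

  clique-in-bag : (ks : List V) → (∀ {x y} → x ∈ ks → y ∈ ks → Touch H x y) →
                  ∃ λ t → ∀ {x} → x ∈ ks → bag D t x
  clique-in-bag ks clique =
    helly ks (λ x t → bag D t x) (λ {x} _ → vertexConnected D x)
             (λ x∈ y∈ → touch-covered (clique x∈ y∈))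

module LineGraphSquare {n : ℕ} (G : SimpleGraph (Fin n)) where

  ends : Edge G → Fin n × Fin n
  ends = proj₁

  ends-injective : ∀ {e f} → ends e ≡ ends f → e ≡ f
  ends-injective {_ , a<b , a~b} {_ , a<b′ , a~b′} refl =
    cong₂ (λ l t → _ , l , t) (Fin.<-irrelevant a<b a<b′) (T-irrelevant a~b a~b′)

  Meets : (Fin n → Set) → Fin n × Fin n → Set
  Meets S p = S (proj₁ p) ⊎ S (proj₂ p)

  Touching : Fin n × Fin n → Fin n × Fin n → Set
  Touching (a , b) (c , d) = Touch G a c ⊎ Touch G a d ⊎ Touch G b c ⊎ Touch G b d

  -- The test used in the definition of L², whose adjacency unfolds to
  -- T (not (isYes (a ≟ c) ∧ isYes (b ≟ d)) ∧
  --    (touch? a c ∨ touch? a d ∨ touch? b c ∨ touch? b d)).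
  touch? : Fin n → Fin n → Bool
  touch? x y = isYes (x Fin.≟ y) ∨ adj G x y

  T-touch? : ∀ {x y} → T (touch? x y) ⇔ Touch G x y
  T-touch? = ⇔-trans T-∨ (mk⇔ toWitness fromWitness ⊎-⇔ ⇔-refl)

  T-touching : ∀ {a b c d} →
               T (touch? a c ∨ touch? a d ∨ touch? b c ∨ touch? b d) ⇔ Touching (a , b) (c , d)
  T-touching =
    ⇔-trans T-∨ (T-touch? ⊎-⇔ ⇔-trans T-∨ (T-touch? ⊎-⇔ ⇔-trans T-∨ (T-touch? ⊎-⇔ T-touch?)))

  T-distinct : ∀ {a b c d : Fin n} →
               T (not (isYes (a Fin.≟ c) ∧ isYes (b Fin.≟ d))) ⇔ ((a , b) ≢ (c , d))
  T-distinct {a} {b} {c} {d} with a Fin.≟ c | b Fin.≟ d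
  ... | yes refl | yes refl = mk⇔ (λ ()) (λ a,b≢a,b → contradiction refl a,b≢a,b)
  ... | no a≢c   | _        = mk⇔ (λ _ → a≢c ∘ cong proj₁) _
  ... | yes _    | no b≢d   = mk⇔ (λ _ → b≢d ∘ cong proj₂) _

  L²-adj⇔ : ∀ {e f} → Adj (L² G) e f ⇔ (ends e ≢ ends f × Touching (ends e) (ends f))
  L²-adj⇔ = ⇔-trans T-∧ (T-distinct ×-⇔ T-touching)

  L²-adj⇒touching : ∀ {e f} → Adj (L² G) e f → Touching (ends e) (ends f)
  L²-adj⇒touching {e} {f} = proj₂ ∘ Equivalence.to (L²-adj⇔ {e} {f})

  touching⇒L²-adj : ∀ {e f} → e ≢ f → Touching (ends e) (ends f) → Adj (L² G) e f
  touching⇒L²-adj {e} {f} e≢f t = Equivalence.from (L²-adj⇔ {e} {f}) (e≢f ∘ ends-injective , t)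

  touching⇒touch : ∀ {e f} → Touching (ends e) (ends f) → Touch (L² G) e f
  touching⇒touch {e} {f} t with ≡-dec Fin._≟_ Fin._≟_ (ends e) (ends f)
  ... | yes same = inj₁ (ends-injective same)
  ... | no ¬same = inj₂ (touching⇒L²-adj {e} {f} (¬same ∘ cong ends) t)

  apart⇔¬touching : ∀ {p q} → InducedApart G p q ⇔ (¬ Touching p q)
  apart⇔¬touching = mk⇔
    (λ (ac , ad , bc , bd) → [ ¬t ac , [ ¬t ad , [ ¬t bc , ¬t bd ]′ ]′ ]′)
    (λ ¬t → split (¬t ∘ inj₁) , split (¬t ∘ inj₂ ∘ inj₁) ,
            split (¬t ∘ inj₂ ∘ inj₂ ∘ inj₁) , split (¬t ∘ inj₂ ∘ inj₂ ∘ inj₂))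
    where
    ¬t : ∀ {x y} → x ≢ y × ¬ Adj G x y → ¬ Touch G x y
    ¬t (x≢y , x≁y) = [ x≢y , x≁y ]′
    split : ∀ {x y} → ¬ Touch G x y → x ≢ y × ¬ Adj G x y
    split ¬t = ¬t ∘ inj₁ , ¬t ∘ inj₂

  apart⇒nonadjacent : ∀ {e f} → InducedApart G (ends e) (ends f) → e ≢ f × ¬ Adj (L² G) e f
  apart⇒nonadjacent {e} {f} apart =
    (λ { refl → ¬touching (inj₁ (inj₁ refl)) }) , ¬touching ∘ L²-adj⇒touching {e} {f}
    where ¬touching = Equivalence.to apart⇔¬touching apart

  nonadjacent⇒apart : ∀ {e f} → e ≢ f → ¬ Adj (L² G) e f → InducedApart G (ends e) (ends f)
  nonadjacent⇒apart e≢f e≁f = Equivalence.from apart⇔¬touching (e≁f ∘ touching⇒L²-adj e≢f)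

  apart-swapˡ : ∀ {a b q} → InducedApart G (a , b) q → InducedApart G (b , a) q
  apart-swapˡ (ac , ad , bc , bd) = bc , bd , ac , ad

  apart-swapʳ : ∀ {p c d} → InducedApart G p (c , d) → InducedApart G p (d , c)
  apart-swapʳ (ac , ad , bc , bd) = ad , ac , bd , bc

  meeting-clique⇒touching : ∀ {A p q} → (∀ {x y} → A x → A y → Touch G x y) →
                            Meets A p → Meets A q → Touching p q
  meeting-clique⇒touching clique (inj₁ Aa) (inj₁ Ac) = inj₁ (clique Aa Ac)
  meeting-clique⇒touching clique (inj₁ Aa) (inj₂ Ad) = inj₂ (inj₁ (clique Aa Ad))
  meeting-clique⇒touching clique (inj₂ Ab) (inj₁ Ac) = inj₂ (inj₂ (inj₁ (clique Ab Ac)))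
  meeting-clique⇒touching clique (inj₂ Ab) (inj₂ Ad) = inj₂ (inj₂ (inj₂ (clique Ab Ad)))

  edgeOf : ∀ {a b} → Adj G a b → Edge G
  edgeOf {a} {b} a~b with Fin.<-cmp a b
  ... | tri< a<b _ _  = (a , b) , a<b , a~b
  ... | tri≈ _ refl _ = contradiction a~b (¬Adj-refl G)
  ... | tri> _ _ b<a  = (b , a) , b<a , Adj-sym G a~b

  edgeOf-ends : ∀ {a b} (P : Fin n × Fin n → Set) (a~b : Adj G a b) → P (a , b) → P (b , a) →
                P (ends (edgeOf a~b))
  edgeOf-ends {a} {b} P a~b Pab Pba with Fin.<-cmp a b
  ... | tri< _ _ _    = Pab
  ... | tri≈ _ refl _ = contradiction a~b (¬Adj-refl G)
  ... | tri> _ _ _    = Pba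

  edgeOf-apart : ∀ {a b c d} (a~b : Adj G a b) (c~d : Adj G c d) → InducedApart G (a , b) (c , d) →
                 InducedApart G (ends (edgeOf a~b)) (ends (edgeOf c~d))
  edgeOf-apart a~b c~d apart = edgeOf-ends (λ p → InducedApart G p (ends (edgeOf c~d))) a~b
    (edgeOf-ends (InducedApart G _) c~d apart (apart-swapʳ apart))
    (edgeOf-ends (InducedApart G _) c~d (apart-swapˡ apart) (apart-swapʳ (apart-swapˡ apart)))

  edgesAt : Fin n → Fin n → List (Edge G)
  edgesAt a b with a Fin.<? b | T? (adj G a b)
  ... | yes a<b | yes a~b = ((a , b) , a<b , a~b) ∷ []
  ... | _       | _       = []

  ∈-edgesAt : (e : Edge G) → e ∈ uncurry edgesAt (ends e)
  ∈-edgesAt ((a , b) , a<b , a~b) with a Fin.<? b | T? (adj G a b)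
  ... | yes _  | yes _  = here (ends-injective refl)
  ... | no a≮b | _      = contradiction a<b a≮b
  ... | yes _  | no a≁b = contradiction a~b a≁b

  edges : List (Edge G)
  edges = concatMap (uncurry edgesAt) (cartesianProduct (allFin n) (allFin n))

  ∈-edges : (e : Edge G) → e ∈ edges
  ∈-edges e = ∈-concatMap⁺ (uncurry edgesAt)
                (lose (∈-cartesianProduct⁺ (∈-allFin _) (∈-allFin _)) (∈-edgesAt e))

  edgesOf : ∀ {es} → All (λ p → Adj G (proj₁ p) (proj₂ p)) es → List (Edge G)
  edgesOf = All.reduce edgeOf

  μ≥⇒α≥ : ∀ {S S′ k} → (Meets S ∘ ends) ⊆ S′ → μ≥ G S k → α≥ (L² G) S′ k
  μ≥⇒α≥ {S} {k = k} meets⊆S′ (es , (adjacent , apart , meets) , k≤) =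
    edgesOf adjacent ,
    ( All-reduce edgeOf (λ a~b m → meets⊆S′ (edgeOf-ends (Meets S) a~b m (Sum.swap m))) adjacent meets
    , AllPairs-reduce edgeOf (λ a~b c~d → apart⇒nonadjacent ∘ edgeOf-apart a~b c~d) adjacent apart) ,
    subst (k ≤ℕ_) (sym (length-reduce edgeOf adjacent)) k≤

  α≥⇒μ≥ : ∀ {S S′ k} → S′ ⊆ (Meets S ∘ ends) → α≥ (L² G) S′ k → μ≥ G S k
  α≥⇒μ≥ {k = k} S′⊆meets (xs , (inside , independent) , k≤) =
    map ends xs ,
    ( All.map⁺ (All.tabulate λ {e} _ → proj₂ (proj₂ e))
    , AllPairs.map⁺ (AllPairs.map (uncurry nonadjacent⇒apart) independent)
    , All.map⁺ (All.map S′⊆meets inside)) ,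
    subst (k ≤ℕ_) (sym (length-map ends xs)) k≤

  μ≤⇒α≤ : ∀ {S S′ k} → S′ ⊆ (Meets S ∘ ends) → μ≤ G S k → α≤ (L² G) S′ k
  μ≤⇒α≤ S′⊆meets μ≤k xs independent =
    let es , matching , |xs|≤|es| = α≥⇒μ≥ S′⊆meets (xs , independent , ≤-refl)
    in ≤-trans |xs|≤|es| (μ≤k es matching)

  α≤⇒μ≤ : ∀ {S S′ k} → (Meets S ∘ ends) ⊆ S′ → α≤ (L² G) S′ k → μ≤ G S k
  α≤⇒μ≤ meets⊆S′ α≤k es matching =
    let xs , independent , |es|≤|xs| = μ≥⇒α≥ meets⊆S′ (es , matching , ≤-refl)
    in ≤-trans |es|≤|xs| (α≤k xs independent)

  touching-covered : (D : TreeDecomposition G) → ∀ {p q} → Touching p q →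
                     ∃ λ t → Meets (bag D t) p × Meets (bag D t) q
  touching-covered D (inj₁ ac)               = Product.map₂ (Product.map inj₁ inj₁) (touch-covered D ac)
  touching-covered D (inj₂ (inj₁ ad))        = Product.map₂ (Product.map inj₁ inj₂) (touch-covered D ad)
  touching-covered D (inj₂ (inj₂ (inj₁ bc))) = Product.map₂ (Product.map inj₂ inj₁) (touch-covered D bc)
  touching-covered D (inj₂ (inj₂ (inj₂ bd))) = Product.map₂ (Product.map inj₂ inj₂) (touch-covered D bd)

  liftDecomposition : TreeDecomposition G → TreeDecomposition (L² G)
  liftDecomposition D = record
    { nodes           = nodes D
    ; tree            = tree D
    ; isTree          = isTree D
    ; bag             = λ t e → Meets (bag D t) (ends e)
    ; vertexConnected = λ (_ , _ , a~b) →
        ∪-connected (vertexConnected D _) (vertexConnected D _) (edgeCovered D _ _ a~b)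
    ; edgeCovered     = λ e f e~f → touching-covered D (L²-adj⇒touching {e} {f} e~f)
    }

  module _ (D : TreeDecomposition (L² G)) where
    open Trees (isTree D) using (⋂-connected)

    edges-meeting-clique-in-bag : ∀ {A} → Decidable A → (∀ {x y} → A x → A y → Touch G x y) →
                                  ∃ λ t → ∀ e → Meets A (ends e) → bag D t e
    edges-meeting-clique-in-bag {A} A? clique =
      Product.map₂ (λ in-t e meets → in-t (∈-filter⁺ meets? (∈-edges e) meets))
                   (clique-in-bag D (filter meets? edges) λ e∈ f∈ →
                      touching⇒touch (meeting-clique⇒touching clique (meets-of e∈) (meets-of f∈)))
      where
      meets? : Decidable (Meets A ∘ ends)
      meets? e = A? (proj₁ (ends e)) ⊎-dec A? (proj₂ (ends e))
      meets-of : ∀ {e} → e ∈ filter meets? edges → Meets A (ends e)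
      meets-of = proj₂ ∘ ∈-filter⁻ meets? {xs = edges}

    lowerBag : Fin (nodes D) → Fin n → Set
    lowerBag t v = ∀ e → Meets ｛ v ｝ (ends e) → bag D t e

    lowerBag-meeting : ∀ t → (Meets (lowerBag t) ∘ ends) ⊆ bag D t
    lowerBag-meeting t {e} (inj₁ in-t) = in-t e (inj₁ refl)
    lowerBag-meeting t {e} (inj₂ in-t) = in-t e (inj₂ refl)

    lowerBag-connected : ∀ v → InducesConnected (tree D) (λ t → lowerBag t v)
    lowerBag-connected v =
      edges-meeting-clique-in-bag (v Fin.≟_) (λ { refl refl → inj₁ refl }) ,
      λ t t′ in-t in-t′ → mapᵂ curry (⋂-connected (λ (e , _) → proj₂ (vertexConnected D e))
                                                   t t′ (uncurry in-t) (uncurry in-t′))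

    lowerBag-covers : ∀ u v → Adj G u v → ∃ λ t → lowerBag t u × lowerBag t v
    lowerBag-covers u v u~v =
      Product.map₂ (λ in-t → (λ e → in-t e ∘ Sum.map inj₁ inj₁) , (λ e → in-t e ∘ Sum.map inj₂ inj₂))
        (edges-meeting-clique-in-bag (λ x → (u Fin.≟ x) ⊎-dec (v Fin.≟ x))
          λ { (inj₁ refl) (inj₁ refl) → inj₁ refl
            ; (inj₁ refl) (inj₂ refl) → inj₂ u~v
            ; (inj₂ refl) (inj₁ refl) → inj₂ (Adj-sym G u~v)
            ; (inj₂ refl) (inj₂ refl) → inj₁ refl })

    lowerDecomposition : TreeDecomposition G
    lowerDecomposition = record
      { nodes           = nodes D
      ; tree            = tree D
      ; isTree          = isTree D
      ; bag             = lowerBag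
      ; vertexConnected = lowerBag-connected
      ; edgeCovered     = lowerBag-covers
      }

mainTheorem5 : (n : ℕ) (G : SimpleGraph (Fin n)) (k : ℕ) →
               IsMuTw G k ⇔ IsAlphaTw (L² G) k
mainTheorem5 n G k = mk⇔ μ⇒α α⇒μ
  where
  open LineGraphSquare G

  μ⇒α : IsMuTw G k → IsAlphaTw (L² G) k
  μ⇒α ((D , μ≤k) , μ≥k) =
    (liftDecomposition D , λ t → μ≤⇒α≤ (λ e∈ → e∈) (μ≤k t)) ,
    λ D′ → let t , μ≥k-at-t = μ≥k (lowerDecomposition D′)
           in t , μ≥⇒α≥ (lowerBag-meeting D′ t) μ≥k-at-t

  α⇒μ : IsAlphaTw (L² G) k → IsMuTw G k
  α⇒μ ((D′ , α≤k) , α≥k) =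
    (lowerDecomposition D′ , λ t → α≤⇒μ≤ (lowerBag-meeting D′ t) (α≤k t)) ,
    λ D → let t , α≥k-at-t = α≥k (liftDecomposition D)
          in t , α≥⇒μ≥ (λ e∈ → e∈) α≥k-at-t
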